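{- Let $F$ be a CNF formula with $n$ variables and $m$ clauses, and consider its clause-literal graph with vertices numbered by $[2n+m]$ so that the $2n$ literal vertices are numbered $1,\dots,2n$ and the $m$ clause vertices are numbered $2n+1,\dots,2n+m$. Among all such numberings, consider one whose adjacency matrix $A$ is lexicographically minimal (comparing the vectors obtained by concatenating the rows of the adjacency matrix). Then for all $i,j\leq 2n$ we have $A_{i,j}=1$ if and only if $i+j=2n+1$. Equivalently, for each variable, its positive and negative literal are numbered $j$ and $2n+1-j$ for some $j\in[n]$.
   Context: A literal is a propositional variable $x$ or its negation $\overline{x}$; a clause is a finite set of literals not containing both a literal and its negation; a CNF formula is a finite set of clauses. The clause-literal graph of $F$ is the undirected graph whose vertex set is the disjoint union of the set of literals of $F$ (both $x$ and $\overline{x}$ for every variable $x$ of $F$) and the set of clauses of $F$, with edges $\{x,\overline{x}\}$ for each variable $x$ of $F$ and $\{C,\ell\}$ for each clause $C\in F$ and literal $\ell\in C$. The adjacency matrix $A$ of a graph on vertex set $[N]$ has $A_{u,v}=1$ iff $uv$ is an edge. -}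

module Defs where

open import Data.Nat using (ℕ; zero; suc; _+_; _*_; _<_; _≤_)
open import Data.Fin using (Fin; toℕ; _≟_)
open import Data.Fin.Base using ()
open import Data.Bool using (Bool; true; false; _∧_; _xor_)
open import Data.Product using (_×_; _,_; Σ; ∃)
open import Data.Sum using (_⊎_; inj₁; inj₂)
open import Data.List using (List; []; _∷_; concatMap)
open import Data.List.Base using ()
open import Data.Fin.Base using ()
open import Data.List using (allFin)
open import Relation.Binary.PropositionalEquality using (_≡_)
open import Relation.Nullary using (¬_)
open import Relation.Nullary.Decidable using (⌊_⌋)
open import Function.Bundles using (_⤖_; Bijection)

-- Literals over variables Fin n: (x , true) is x, (x , false) is the negation x̄.
Lit : ℕ → Set
Lit n = Fin n × Bool

Clause : ℕ → Set
Clause n = Lit n → Bool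

-- A CNF formula with exactly n variables and m clauses:
-- m pairwise distinct clauses (a set of clauses), no clause contains a
-- literal together with its negation, and every variable 0..n-1 occurs in F
-- (so that the variables of F are exactly Fin n).
record CNF (n m : ℕ) : Set where
  field
    clause     : Fin m → Clause n
    distinct   : ∀ i j → (∀ l → clause i l ≡ clause j l) → i ≡ j
    nonTaut    : ∀ i x → ¬ (clause i (x , true) ≡ true × clause i (x , false) ≡ true)
    occurs     : ∀ x → ∃ λ i → ∃ λ b → clause i (x , b) ≡ true

Vertex : ℕ → ℕ → Set
Vertex n m = Lit n ⊎ Fin m

isLit : ∀ {n m} → Vertex n m → Bool
isLit (inj₁ _) = true
isLit (inj₂ _) = false

adj : ∀ {n m} → CNF n m → Vertex n m → Vertex n m → Bool
adj F (inj₁ (x , b)) (inj₁ (y , c)) = ⌊ x ≟ y ⌋ ∧ (b xor c)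
adj F (inj₁ l) (inj₂ k) = CNF.clause F k l
adj F (inj₂ k) (inj₁ l) = CNF.clause F k l
adj F (inj₂ _) (inj₂ _) = false

-- A numbering: a bijection from positions Fin (2n+m) (position i is the
-- 0-based version of number i+1) onto the vertices, such that the literal
-- vertices get exactly the positions 0 .. 2n-1.
record Numbering (n m : ℕ) : Set where
  field
    σ       : Fin (2 * n + m) ⤖ Vertex n m
    litLow  : ∀ i → toℕ i < 2 * n → isLit (Bijection.to σ i) ≡ true
    clsHigh : ∀ i → 2 * n ≤ toℕ i → isLit (Bijection.to σ i) ≡ false

adjMatrix : ∀ {n m} → CNF n m → Numbering n m →
            Fin (2 * n + m) → Fin (2 * n + m) → Bool
adjMatrix F ν i j = adj F (Bijection.to (Numbering.σ ν) i) (Bijection.to (Numbering.σ ν) j)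

flatten : ∀ {N} → (Fin N → Fin N → Bool) → List Bool
flatten {N} A = concatMap (λ i → Data.List.map (A i) (allFin N)) (allFin N)

data _≤lex_ : List Bool → List Bool → Set where
  []≤    : ∀ {ys} → [] ≤lex ys
  lt     : ∀ {xs ys} → (false ∷ xs) ≤lex (true ∷ ys)
  same   : ∀ {b xs ys} → xs ≤lex ys → (b ∷ xs) ≤lex (b ∷ ys)

LexMin : ∀ {n m} → CNF n m → Numbering n m → Set
LexMin F ν = ∀ (τ : Numbering _ _) → flatten (adjMatrix F ν) ≤lex flatten (adjMatrix F τ)

-- On the literal positions 0 … T−1 (T = 2n) the adjacency matrix is a perfect matching: every
-- literal is adjacent to exactly one literal, its complement.  We show p + q + 1 = T for every
-- matched pair p < q, by strong induction on p.  If p + q + 1 > T, the mirror position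
-- r = T−1−q is smaller than p, so by induction r is matched to q, and q would have two partners.
-- If p + q + 1 < T, swapping q with t = T−1−p fixes every row before p (those rows are matched
-- to their own mirrors, which are neither q nor t) and every entry of row p before column q,
-- but turns the entry (p, q) from 1 into 0: the swapped numbering is lexicographically smaller.

module Submission where

open import Defs
open import Data.Nat using (ℕ; suc; _+_; _*_; _<_; _≤_; _∸_; s≤s; z≤n; s<s⁻¹; _<?_)
open import Data.Nat.Properties
  using (+-comm; suc-injective; +-cancelˡ-≡; +-cancelʳ-<; +-cancelˡ-<; +-monoˡ-<; m≤n+m; m≤m+n;
         <-trans; <-≤-trans; <⇒≢; <-cmp; ≮⇒≥; ∸-monoʳ-<; m+[n∸m]≡n)
open import Data.Fin using (Fin; toℕ; fromℕ<; _≟_)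
open import Data.Fin.Properties using (toℕ-injective; toℕ-fromℕ<)
  renaming (<-cmp to <-cmpᶠ; <⇒≢ to <⇒≢ᶠ)
open import Data.Fin.Induction using (<-wellFounded)
open import Data.Fin.Permutation using (Permutation′; _⟨$⟩ʳ_; transpose)
open import Data.Bool using (Bool; true; false; not; _∧_; _xor_)
open import Data.Bool.Properties using (¬-not; xor-comm; xor-same; not-distribʳ-xor)
open import Data.Product using (_×_; _,_; ∃)
open import Data.Sum using (inj₁; inj₂)
open import Data.List using (List; []; _∷_; _++_; concat; tabulate)
open import Data.List.Properties using (map-tabulate; tabulate-cong)
open import Induction.WellFounded using (module All)
open import Relation.Nullary using (¬_; yes; no; contradiction)
open import Relation.Nullary.Decidable using (⌊_⌋)
open import Relation.Binary.Definitions using (tri<; tri≈; tri>)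
open import Relation.Binary.PropositionalEquality
open import Function.Base using (_∘_)
open import Function.Bundles using (_⇔_; mk⇔; Bijection)
open import Function.Construct.Composition using (_⤖-∘_)
open import Function.Properties.Inverse using (↔⇒⤖)

data _>lex_ : List Bool → List Bool → Set where
  here  : ∀ {xs ys} → (true ∷ xs) >lex (false ∷ ys)
  there : ∀ {b xs ys} → xs >lex ys → (b ∷ xs) >lex (b ∷ ys)

>lex⇒≰lex : ∀ {xs ys} → xs >lex ys → ¬ xs ≤lex ys
>lex⇒≰lex here      ()
>lex⇒≰lex (there d) (same h) = >lex⇒≰lex d h

>lex-++ : ∀ {xs ys} zs ws → xs >lex ys → (xs ++ zs) >lex (ys ++ ws)
>lex-++ zs ws here      = here
>lex-++ zs ws (there d) = there (>lex-++ zs ws d)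

++->lex : ∀ {xs ys} zs → xs >lex ys → (zs ++ xs) >lex (zs ++ ys)
++->lex []       d = d
++->lex (z ∷ zs) d = there (++->lex zs d)

tabulate->lex : ∀ {N} {a b : Fin N → Bool} k → (∀ j → toℕ j < toℕ k → a j ≡ b j) →
                a k ≡ true → b k ≡ false → tabulate a >lex tabulate b
tabulate->lex Fin.zero agree ak bk rewrite ak | bk = here
tabulate->lex (Fin.suc k) agree ak bk
  rewrite agree Fin.zero (s≤s z≤n) =
  there (tabulate->lex k (λ j j<k → agree (Fin.suc j) (s≤s j<k)) ak bk)

concat-tabulate->lex : ∀ {N} {f g : Fin N → List Bool} k → (∀ j → toℕ j < toℕ k → f j ≡ g j) →
                       f k >lex g k → concat (tabulate f) >lex concat (tabulate g)
concat-tabulate->lex Fin.zero agree d = >lex-++ _ _ d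
concat-tabulate->lex (Fin.suc k) agree d
  rewrite agree Fin.zero (s≤s z≤n) =
  ++->lex _ (concat-tabulate->lex k (λ j j<k → agree (Fin.suc j) (s≤s j<k)) d)

flatten-tabulate : ∀ {N} (M : Fin N → Fin N → Bool) →
                   flatten M ≡ concat (tabulate (λ i → tabulate (M i)))
flatten-tabulate M = cong concat (trans (map-tabulate _ _)
  (tabulate-cong (λ i → map-tabulate _ (M i))))

flatten->lex : ∀ {N} (M M′ : Fin N → Fin N → Bool) p q →
               (∀ r → toℕ r < toℕ p → ∀ c → M r c ≡ M′ r c) →
               (∀ c → toℕ c < toℕ q → M p c ≡ M′ p c) →
               M p q ≡ true → M′ p q ≡ false → flatten M >lex flatten M′
flatten->lex M M′ p q rows row Mpq M′pq
  rewrite flatten-tabulate M | flatten-tabulate M′ =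
  concat-tabulate->lex p (λ r r<p → tabulate-cong (rows r r<p)) (tabulate->lex q row Mpq M′pq)

module _ {N : ℕ} (a b : Fin N) where
  transpose-matchˡ : transpose a b ⟨$⟩ʳ a ≡ b
  transpose-matchˡ with a ≟ a
  ... | yes _ = refl
  ... | no a≢a = contradiction refl a≢a

  transpose-other : ∀ {k} → k ≢ a → k ≢ b → transpose a b ⟨$⟩ʳ k ≡ k
  transpose-other {k} k≢a k≢b with k ≟ a
  ... | yes k≡a = contradiction k≡a k≢a
  ... | no _ with k ≟ b
  ...   | yes k≡b = contradiction k≡b k≢b
  ...   | no _ = refl

relabel : ∀ {N} → Permutation′ N → (Fin N → Fin N → Bool) → Fin N → Fin N → Bool
relabel π M i j = M (π ⟨$⟩ʳ i) (π ⟨$⟩ʳ j)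

relabel-transpose-row : ∀ {N} (M : Fin N → Fin N → Bool) {a b r} → r ≢ a → r ≢ b →
                        M r a ≡ false → M r b ≡ false →
                        ∀ c → M r c ≡ relabel (transpose a b) M r c
relabel-transpose-row M {a} {b} {r} r≢a r≢b Mra Mrb c
  rewrite transpose-other a b r≢a r≢b with c ≟ a
... | yes refl = trans Mra (sym Mrb)
... | no _ with c ≟ b
...   | yes refl = trans Mrb (sym Mra)
...   | no _ = refl

module LexMinimalMatching
  {N T : ℕ} (T≤N : T ≤ N) (A : Fin N → Fin N → Bool)
  (A-sym : ∀ p q → A p q ≡ A q p)
  (A-irrefl : ∀ p → A p p ≡ false)
  (partner : ∀ p → toℕ p < T → ∃ λ q → toℕ q < T × A p q ≡ true)
  (partner-unique : ∀ {p q q′} → toℕ p < T → toℕ q < T → toℕ q′ < T →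
                    A p q ≡ true → A p q′ ≡ true → q ≡ q′)
  (lexMin : ∀ a b → toℕ a < T → toℕ b < T →
            flatten A ≤lex flatten (relabel (transpose a b) A))
  where

  record Opposite (p q : Fin N) : Set where
    constructor opposite
    field sum≡ : suc (toℕ p + toℕ q) ≡ T

  opposite-sym : ∀ {p q} → Opposite p q → Opposite q p
  opposite-sym {p} {q} (opposite sum≡) = opposite (trans (cong suc (+-comm (toℕ q) (toℕ p))) sum≡)

  opposite-uniqueʳ : ∀ {p q q′} → Opposite p q → Opposite p q′ → q ≡ q′
  opposite-uniqueʳ {p} (opposite sum≡) (opposite sum≡′) =
    toℕ-injective (+-cancelˡ-≡ (toℕ p) _ _ (suc-injective (trans sum≡ (sym sum≡′))))

  opposite-uniqueˡ : ∀ {p p′ q} → Opposite p q → Opposite p′ q → p ≡ p′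
  opposite-uniqueˡ opp opp′ = opposite-uniqueʳ (opposite-sym opp) (opposite-sym opp′)

  opposite-< : ∀ {p q} → Opposite p q → toℕ q < T
  opposite-< {p} {q} (opposite sum≡) = subst (toℕ q <_) sum≡ (s≤s (m≤n+m (toℕ q) (toℕ p)))

  mirror : (p : Fin N) → toℕ p < T → Fin N
  mirror p p<T = fromℕ< (<-≤-trans (∸-monoʳ-< (s≤s z≤n) p<T) T≤N)

  opposite-mirror : ∀ p (p<T : toℕ p < T) → Opposite p (mirror p p<T)
  opposite-mirror p p<T = opposite (begin
    suc (toℕ p + toℕ (mirror p p<T)) ≡⟨ cong (λ k → suc (toℕ p + k)) (toℕ-fromℕ< _) ⟩
    suc (toℕ p) + (T ∸ suc (toℕ p))  ≡⟨ m+[n∸m]≡n p<T ⟩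
    T                                ∎)
    where open ≡-Reasoning

  PartnersOpposite : Fin N → Set
  PartnersOpposite p = ∀ q → toℕ p < T → toℕ q < T → A p q ≡ true → Opposite p q

  PartnersOppositeBelow : Fin N → Set
  PartnersOppositeBelow p = ∀ {r} → toℕ r < toℕ p → PartnersOpposite r

  partner-not-beyond : ∀ {p q} → PartnersOppositeBelow p → toℕ p < T → toℕ q < T →
                       A p q ≡ true → ¬ T < suc (toℕ p + toℕ q)
  partner-not-beyond {p} {q} below p<T q<T Apq T<pq = <⇒≢ r<p (cong toℕ r≡p)
    where
      r = mirror q q<T
      opp-rq : Opposite r q
      opp-rq = opposite-sym (opposite-mirror q q<T)
      r<T = opposite-< (opposite-mirror q q<T)
      r<p : toℕ r < toℕ p
      r<p = +-cancelʳ-< (toℕ q) (toℕ r) (toℕ p)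
              (s<s⁻¹ (subst (_< suc (toℕ p + toℕ q)) (sym (Opposite.sum≡ opp-rq)) T<pq))
      r≡p : r ≡ p
      r≡p with partner r r<T
      ... | c , c<T , Arc =
        partner-unique q<T r<T p<T (trans (A-sym q r) Arq) (trans (A-sym q p) Apq)
        where
          Arq : A r q ≡ true
          Arq = subst (λ z → A r z ≡ true) (opposite-uniqueʳ (below r<p c r<T c<T Arc) opp-rq) Arc

  partner-not-before : ∀ {p q} → PartnersOppositeBelow p → toℕ p < T → toℕ q < T →
                       toℕ p < toℕ q → A p q ≡ true → ¬ suc (toℕ p + toℕ q) < T
  partner-not-before {p} {q} below p<T q<T p<q Apq pq<T =
    >lex⇒≰lex (flatten->lex A B p q rows-before-p row-p Apq Bpq) (lexMin q t q<T t<T)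
    where
      t = mirror p p<T
      opp-pt = opposite-mirror p p<T
      t<T = opposite-< opp-pt
      q<t : toℕ q < toℕ t
      q<t = +-cancelˡ-< (toℕ p) (toℕ q) (toℕ t)
              (s<s⁻¹ (subst (suc (toℕ p + toℕ q) <_) (sym (Opposite.sum≡ opp-pt)) pq<T))
      B = relabel (transpose q t) A
      p-fixed : transpose q t ⟨$⟩ʳ p ≡ p
      p-fixed = transpose-other q t (<⇒≢ᶠ p<q) (<⇒≢ᶠ (<-trans p<q q<t))
      rows-before-p : ∀ r → toℕ r < toℕ p → ∀ c → A r c ≡ B r c
      rows-before-p r r<p = relabel-transpose-row A (<⇒≢ᶠ (<-trans r<p p<q))
        (<⇒≢ᶠ (<-trans r<p (<-trans p<q q<t))) Arq Art
        where
          r<T = <-trans r<p p<T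
          Arq : A r q ≡ false
          Arq = ¬-not λ Arq → <⇒≢ (<-trans (s≤s (+-monoˡ-< (toℕ q) r<p)) pq<T)
                                  (Opposite.sum≡ (below r<p q r<T q<T Arq))
          Art : A r t ≡ false
          Art = ¬-not λ Art → <⇒≢ᶠ r<p (opposite-uniqueˡ (below r<p t r<T t<T Art) opp-pt)
      row-p : ∀ c → toℕ c < toℕ q → A p c ≡ B p c
      row-p c c<q =
        sym (cong₂ A p-fixed (transpose-other q t (<⇒≢ᶠ c<q) (<⇒≢ᶠ (<-trans c<q q<t))))
      Bpq : B p q ≡ false
      Bpq = trans (cong₂ A p-fixed (transpose-matchˡ q t))
                  (¬-not λ Apt → <⇒≢ᶠ q<t (partner-unique p<T q<T t<T Apq Apt))

  partners-opposite : ∀ p → PartnersOpposite p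
  partners-opposite = All.wfRec <-wellFounded _ PartnersOpposite step
    where
      step : ∀ p → PartnersOppositeBelow p → PartnersOpposite p
      step p below q p<T q<T Apq with <-cmpᶠ p q
      ... | tri> _ _ q<p = opposite-sym (below q<p p q<T p<T (trans (A-sym q p) Apq))
      ... | tri≈ _ refl _ = contradiction (trans (sym (A-irrefl p)) Apq) λ ()
      ... | tri< p<q _ _ with <-cmp (suc (toℕ p + toℕ q)) T
      ...   | tri≈ _ sum≡ _ = opposite sum≡
      ...   | tri< too-close _ _ =
        contradiction too-close (partner-not-before below p<T q<T p<q Apq)
      ...   | tri> _ _ too-far = contradiction too-far (partner-not-beyond below p<T q<T Apq)

  partner⇔opposite : ∀ p q → toℕ p < T → toℕ q < T →
                     (A p q ≡ true) ⇔ (suc (toℕ p + toℕ q) ≡ T)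
  partner⇔opposite p q p<T q<T =
    mk⇔ (Opposite.sum≡ ∘ partners-opposite p q p<T q<T) (opposite⇒partner ∘ opposite)
    where
      opposite⇒partner : Opposite p q → A p q ≡ true
      opposite⇒partner opp with partner p p<T
      ... | c , c<T , Apc =
        subst (λ z → A p z ≡ true) (opposite-uniqueʳ (partners-opposite p c p<T c<T Apc) opp) Apc

⌊≟⌋-sym : ∀ {n} (x y : Fin n) → ⌊ x ≟ y ⌋ ≡ ⌊ y ≟ x ⌋
⌊≟⌋-sym x y with x ≟ y | y ≟ x
... | yes _   | yes _   = refl
... | no _    | no _    = refl
... | yes x≡y | no y≢x  = contradiction (sym x≡y) y≢x
... | no x≢y  | yes y≡x = contradiction (sym y≡x) x≢y

xor≡true⇒≡not : ∀ {b c} → b xor c ≡ true → c ≡ not b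
xor≡true⇒≡not {true}  {false} _  = refl
xor≡true⇒≡not {false} {true}  _  = refl
xor≡true⇒≡not {true}  {true}  ()
xor≡true⇒≡not {false} {false} ()

module _ {n m : ℕ} (F : CNF n m) where

  adj-sym : ∀ u v → adj F u v ≡ adj F v u
  adj-sym (inj₁ (x , b)) (inj₁ (y , c)) = cong₂ _∧_ (⌊≟⌋-sym x y) (xor-comm b c)
  adj-sym (inj₁ _) (inj₂ _) = refl
  adj-sym (inj₂ _) (inj₁ _) = refl
  adj-sym (inj₂ _) (inj₂ _) = refl

  adj-irrefl : ∀ u → adj F u u ≡ false
  adj-irrefl (inj₁ (x , b)) with x ≟ x
  ... | yes _ = xor-same b
  ... | no _  = refl
  adj-irrefl (inj₂ _) = refl

  adj-complement : ∀ x b → adj F (inj₁ (x , b)) (inj₁ (x , not b)) ≡ true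
  adj-complement x b with x ≟ x
  ... | yes _   = trans (sym (not-distribʳ-xor b b)) (cong not (xor-same b))
  ... | no x≢x = contradiction refl x≢x

  adj-literal⇒complement : ∀ {x b l} → adj F (inj₁ (x , b)) (inj₁ l) ≡ true → l ≡ (x , not b)
  adj-literal⇒complement {x} {b} {y , c} xy with x ≟ y
  ... | yes refl = cong (x ,_) (xor≡true⇒≡not xy)
  ... | no _ = contradiction xy λ ()

module _ {n m : ℕ} (ν : Numbering n m) where
  open Numbering ν

  vertex : Fin (2 * n + m) → Vertex n m
  vertex = Bijection.to σ

  renumber : (π : Permutation′ (2 * n + m)) →
             (∀ i → isLit (vertex (π ⟨$⟩ʳ i)) ≡ isLit (vertex i)) → Numbering n m
  renumber π preserves = record
    { σ       = σ ⤖-∘ ↔⇒⤖ π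
    ; litLow  = λ i i<2n → trans (preserves i) (litLow i i<2n)
    ; clsHigh = λ i 2n≤i → trans (preserves i) (clsHigh i 2n≤i)
    }

  transpose-preserves-isLit : ∀ {a b} → toℕ a < 2 * n → toℕ b < 2 * n →
                              ∀ i → isLit (vertex (transpose a b ⟨$⟩ʳ i)) ≡ isLit (vertex i)
  transpose-preserves-isLit {a} {b} a<2n b<2n i with i ≟ a
  ... | yes refl = trans (litLow b b<2n) (sym (litLow a a<2n))
  ... | no _ with i ≟ b
  ...   | yes refl = trans (litLow a a<2n) (sym (litLow b b<2n))
  ...   | no _ = refl

  literal⇒block : ∀ p → isLit (vertex p) ≡ true → toℕ p < 2 * n
  literal⇒block p lit with toℕ p <? 2 * n
  ... | yes p<2n = p<2n
  ... | no p≮2n = contradiction (trans (sym lit) (clsHigh p (≮⇒≥ p≮2n))) λ ()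

  block⇒literal : ∀ p → toℕ p < 2 * n → ∃ λ l → vertex p ≡ inj₁ l
  block⇒literal p p<2n with vertex p | litLow p p<2n
  ... | inj₁ l | _ = l , refl

  module _ (F : CNF n m) where

    partner : ∀ p → toℕ p < 2 * n → ∃ λ q → toℕ q < 2 * n × adjMatrix F ν p q ≡ true
    partner p p<2n with block⇒literal p p<2n
    ... | (x , b) , p↦xb with Bijection.surjective σ (inj₁ (x , not b))
    ...   | q , q↦x̄b = q , literal⇒block q (cong isLit (q↦x̄b refl)) ,
                      trans (cong₂ (adj F) p↦xb (q↦x̄b refl)) (adj-complement F x b)

    partner-unique : ∀ {p q q′} → toℕ p < 2 * n → toℕ q < 2 * n → toℕ q′ < 2 * n →
                     adjMatrix F ν p q ≡ true → adjMatrix F ν p q′ ≡ true → q ≡ q′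
    partner-unique {p} {q} {q′} p<2n q<2n q′<2n pq pq′
      with block⇒literal p p<2n | block⇒literal q q<2n | block⇒literal q′ q′<2n
    ... | (x , b) , p↦xb | l , q↦l | l′ , q′↦l′ = Bijection.injective σ (begin
      vertex q            ≡⟨ q↦l ⟩
      inj₁ l              ≡⟨ cong inj₁ (complement q↦l pq) ⟩
      inj₁ (x , not b)    ≡⟨ cong inj₁ (sym (complement q′↦l′ pq′)) ⟩
      inj₁ l′             ≡⟨ sym q′↦l′ ⟩
      vertex q′           ∎)
      where
        open ≡-Reasoning
        complement : ∀ {r k} → vertex r ≡ inj₁ k → adjMatrix F ν p r ≡ true → k ≡ (x , not b)
        complement r↦k pr =
          adj-literal⇒complement F (subst₂ (λ u v → adj F u v ≡ true) p↦xb r↦k pr)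

theorem1 : ∀ (n m : ℕ) (F : CNF n m) (ν : Numbering n m) → LexMin F ν →
    ∀ (i j : Fin (2 * n + m)) → toℕ i < 2 * n → toℕ j < 2 * n →
    (adjMatrix F ν i j ≡ true) ⇔ (suc (toℕ i + toℕ j) ≡ 2 * n)
theorem1 n m F ν lexMin = partner⇔opposite
  where
    open LexMinimalMatching (m≤m+n (2 * n) m) (adjMatrix F ν)
      (λ p q → adj-sym F (vertex ν p) (vertex ν q)) (λ p → adj-irrefl F (vertex ν p))
      (partner ν F) (partner-unique ν F)
      (λ a b a<2n b<2n →
        lexMin (renumber ν (transpose a b) (transpose-preserves-isLit ν a<2n b<2n)))
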